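{- Let $U$ be a set with at least two elements and $\sigma,\tau,\pi$ partitions on $U$. Then $\partial^\pi(\sigma\vee\tau)=\left(\partial^\pi\sigma\vee\tau\right)\wedge\left(\sigma\vee\partial^\pi\tau\right)$, where for any partition $\rho$, $\partial^\pi\rho=\rho\vee(\rho\Rightarrow\pi)$.
   Context: A partition on $U$ is a set of nonempty pairwise disjoint blocks with union $U$; $\operatorname{dit}(\pi)$ is the set of ordered pairs $(u,u')$ with $u,u'$ in different blocks; partitions are identified by their dit sets. For $S\subseteq U\times U$, $\overline S$ is the smallest equivalence relation containing $S$ and $\operatorname{int}(S)=U\times U\setminus\overline{U\times U\setminus S}$. Operations: $\operatorname{dit}(\sigma\vee\tau)=\operatorname{dit}\sigma\cup\operatorname{dit}\tau$; $\operatorname{dit}(\sigma\wedge\tau)=\operatorname{int}(\operatorname{dit}\sigma\cap\operatorname{dit}\tau)$; $\operatorname{dit}(\sigma\Rightarrow\tau)=\operatorname{int}((U\times U\setminus\operatorname{dit}\sigma)\cup\operatorname{dit}\tau)$. -}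

module Defs where

open import Level using (0ℓ)
open import Data.Product using (_×_; _,_)
open import Data.Sum using (_⊎_)
open import Relation.Nullary using (¬_)
open import Relation.Binary.Structures using (IsEquivalence)

PairSet : Set → Set₁
PairSet U = U → U → Set

module _ {U : Set} where

  ∁ : PairSet U → PairSet U
  ∁ S x y = ¬ S x y

  _∪_ : PairSet U → PairSet U → PairSet U
  (S ∪ T) x y = S x y ⊎ T x y

  _∩_ : PairSet U → PairSet U → PairSet U
  (S ∩ T) x y = S x y × T x y

  _≐_ : PairSet U → PairSet U → Set
  S ≐ T = ∀ x y → (S x y → T x y) × (T x y → S x y)

  data EqClosure (S : PairSet U) : U → U → Set where
    incl   : ∀ {x y} → S x y → EqClosure S x y
    erefl  : ∀ {x} → EqClosure S x x
    esym   : ∀ {x y} → EqClosure S x y → EqClosure S y x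
    etrans : ∀ {x y z} → EqClosure S x y → EqClosure S y z → EqClosure S x z

  int : PairSet U → PairSet U
  int S = ∁ (EqClosure (∁ S))

  -- operations on partitions, expressed on dit sets
  _∨ᵈ_ : PairSet U → PairSet U → PairSet U
  S ∨ᵈ T = S ∪ T

  _∧ᵈ_ : PairSet U → PairSet U → PairSet U
  S ∧ᵈ T = int (S ∩ T)

  _⇒ᵈ_ : PairSet U → PairSet U → PairSet U
  S ⇒ᵈ T = int (∁ S ∪ T)

  ∂ : PairSet U → PairSet U → PairSet U
  ∂ π ρ = ρ ∨ᵈ (ρ ⇒ᵈ π)

record Partition (U : Set) : Set₁ where
  field
    _∼_     : U → U → Set
    isEquiv : IsEquivalence _∼_

dit : {U : Set} → Partition U → PairSet U
dit P = ∁ (Partition._∼_ P)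

-- The meet on the right is the interior of the plain intersection of its two dit sets, so it
-- suffices to show that this intersection already is the dit set of the partition on the left.
-- The key fact is that dit(ρ ⇒ π) consists of the pairs x ≠ y that are π-distinct or whose
-- π-block is not split by ρ; hence dit((σ ∨ τ) ⇒ π) = dit(σ ⇒ π) ∩ dit(τ ⇒ π), and the
-- required equality becomes distributivity of ∪ over ∩.
module Submission where

open import Defs
open import Level using (0ℓ)
open import Data.Product using (Σ; _×_; _,_; proj₁; proj₂)
open import Data.Sum using (_⊎_; inj₁; inj₂; map₂)
open import Relation.Nullary using (¬_; yes; no)
open import Relation.Binary.Core using (_⇒_)
open import Relation.Binary.PropositionalEquality using (_≡_; refl)
import Relation.Binary.PropositionalEquality as ≡
open import Relation.Binary.Structures using (IsEquivalence)
open import Axiom.ExcludedMiddle using (ExcludedMiddle)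
open import Axiom.DoubleNegationElimination using (em⇒dne)

module _ {U : Set} where

  ≐-sym : {S T : PairSet U} → S ≐ T → T ≐ S
  ≐-sym S≐T x y = proj₂ (S≐T x y) , proj₁ (S≐T x y)

  ≐-trans : {S T V : PairSet U} → S ≐ T → T ≐ V → S ≐ V
  ≐-trans S≐T T≐V x y =
    (λ s → proj₁ (T≐V x y) (proj₁ (S≐T x y) s)) , (λ v → proj₂ (S≐T x y) (proj₂ (T≐V x y) v))

  ∪-congʳ : (S : PairSet U) {T V : PairSet U} → T ≐ V → (S ∪ T) ≐ (S ∪ V)
  ∪-congʳ S T≐V x y = map₂ (proj₁ (T≐V x y)) , map₂ (proj₂ (T≐V x y))

  ∪-∩-distrib : (S T I J : PairSet U) → (((S ∪ I) ∪ T) ∩ (S ∪ (T ∪ J))) ≐ ((S ∪ T) ∪ (I ∩ J))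
  ∪-∩-distrib S T I J x y = to , from
    where
    to : (((S ∪ I) ∪ T) ∩ (S ∪ (T ∪ J))) x y → ((S ∪ T) ∪ (I ∩ J)) x y
    to (inj₁ (inj₁ s) , _)             = inj₁ (inj₁ s)
    to (inj₂ t , _)                    = inj₁ (inj₂ t)
    to (_ , inj₁ s)                    = inj₁ (inj₁ s)
    to (_ , inj₂ (inj₁ t))             = inj₁ (inj₂ t)
    to (inj₁ (inj₂ i) , inj₂ (inj₂ j)) = inj₂ (i , j)

    from : ((S ∪ T) ∪ (I ∩ J)) x y → (((S ∪ I) ∪ T) ∩ (S ∪ (T ∪ J))) x y
    from (inj₁ (inj₁ s)) = inj₁ (inj₁ s) , inj₁ s
    from (inj₁ (inj₂ t)) = inj₂ t , inj₂ (inj₁ t)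
    from (inj₂ (i , j))  = inj₁ (inj₂ i) , inj₂ (inj₂ j)

  EqClosure-isEquivalence : (S : PairSet U) → IsEquivalence (EqClosure S)
  EqClosure-isEquivalence S = record { refl = erefl ; sym = esym ; trans = etrans }

  EqClosure-minimal : {S R : PairSet U} → IsEquivalence R → S ⇒ R → EqClosure S ⇒ R
  EqClosure-minimal R-equiv S⊆R (incl s)     = S⊆R s
  EqClosure-minimal R-equiv S⊆R erefl        = IsEquivalence.refl R-equiv
  EqClosure-minimal R-equiv S⊆R (esym c)     = IsEquivalence.sym R-equiv (EqClosure-minimal R-equiv S⊆R c)
  EqClosure-minimal R-equiv S⊆R (etrans c d) =
    IsEquivalence.trans R-equiv (EqClosure-minimal R-equiv S⊆R c) (EqClosure-minimal R-equiv S⊆R d)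

  EqClosure-mono : {S T : PairSet U} → S ⇒ T → EqClosure S ⇒ EqClosure T
  EqClosure-mono {T = T} S⊆T = EqClosure-minimal (EqClosure-isEquivalence T) (λ s → incl (S⊆T s))

  int-cong : {S T : PairSet U} → S ≐ T → int S ≐ int T
  int-cong S≐T x y =
    (λ ¬cS cT → ¬cS (EqClosure-mono (λ {a} {b} ¬t s → ¬t (proj₁ (S≐T a b) s)) cT)) ,
    (λ ¬cT cS → ¬cT (EqClosure-mono (λ {a} {b} ¬s t → ¬s (proj₂ (S≐T a b) t)) cS))

  Splits : PairSet U → PairSet U → U → Set
  Splits D P x = Σ U λ z → P x z × D x z

  -- Same block of D ⇒ π, where P is the equivalence relation of π.
  Indit⇒ : PairSet U → PairSet U → PairSet U
  Indit⇒ D P x y = x ≡ y ⊎ (P x y × Splits D P x)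

  Indit⇒-∪ : (S T P : PairSet U) → ∀ {x y} → Indit⇒ (S ∪ T) P x y → Indit⇒ S P x y ⊎ Indit⇒ T P x y
  Indit⇒-∪ S T P (inj₁ x≡y)                      = inj₁ (inj₁ x≡y)
  Indit⇒-∪ S T P (inj₂ (Pxy , z , Pxz , inj₁ s)) = inj₁ (inj₂ (Pxy , z , Pxz , s))
  Indit⇒-∪ S T P (inj₂ (Pxy , z , Pxz , inj₂ t)) = inj₂ (inj₂ (Pxy , z , Pxz , t))

  Indit⇒-∪ˡ : (S T P : PairSet U) → Indit⇒ S P ⇒ Indit⇒ (S ∪ T) P
  Indit⇒-∪ˡ S T P (inj₁ x≡y)                = inj₁ x≡y
  Indit⇒-∪ˡ S T P (inj₂ (Pxy , z , Pxz , s)) = inj₂ (Pxy , z , Pxz , inj₁ s)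

  Indit⇒-∪ʳ : (S T P : PairSet U) → Indit⇒ T P ⇒ Indit⇒ (S ∪ T) P
  Indit⇒-∪ʳ S T P (inj₁ x≡y)                = inj₁ x≡y
  Indit⇒-∪ʳ S T P (inj₂ (Pxy , z , Pxz , t)) = inj₂ (Pxy , z , Pxz , inj₂ t)

module Classical (em : ExcludedMiddle 0ℓ) {U : Set} where

  dne : {A : Set} → ¬ ¬ A → A
  dne = em⇒dne em

  IsDitSet : PairSet U → Set
  IsDitSet D = IsEquivalence (∁ D)

  dit-isDitSet : (ρ : Partition U) → IsDitSet (dit ρ)
  dit-isDitSet ρ = record
    { refl  = λ ¬∼ → ¬∼ ρ.refl
    ; sym   = λ ¬¬xy yx → ¬¬xy (λ xy → yx (ρ.sym xy))
    ; trans = λ ¬¬xy ¬¬yz xz → ¬¬xy (λ xy → ¬¬yz (λ yz → xz (ρ.trans xy yz)))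
    }
    where module ρ = IsEquivalence (Partition.isEquiv ρ)

  ∪-isDitSet : {S T : PairSet U} → IsDitSet S → IsDitSet T → IsDitSet (S ∪ T)
  ∪-isDitSet {S} {T} S-dit T-dit = record
    { refl  = join S.refl T.refl
    ; sym   = λ c → join (S.sym (¬S c)) (T.sym (¬T c))
    ; trans = λ c d → join (S.trans (¬S c) (¬S d)) (T.trans (¬T c) (¬T d))
    }
    where
    module S = IsEquivalence S-dit
    module T = IsEquivalence T-dit
    join : ∀ {x y} → ∁ S x y → ∁ T x y → ∁ (S ∪ T) x y
    join ¬s ¬t (inj₁ s) = ¬s s
    join ¬s ¬t (inj₂ t) = ¬t t
    ¬S : ∀ {x y} → ∁ (S ∪ T) x y → ∁ S x y
    ¬S c s = c (inj₁ s)
    ¬T : ∀ {x y} → ∁ (S ∪ T) x y → ∁ T x y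
    ¬T c t = c (inj₂ t)

  int-isDitSet : (S : PairSet U) → IsDitSet (int S)
  int-isDitSet S = record
    { refl  = λ ¬c → ¬c erefl
    ; sym   = λ c ¬c → ¬c (esym (dne c))
    ; trans = λ c d ¬c → ¬c (etrans (dne c) (dne d))
    }

  ∂-isDitSet : (Π D : PairSet U) → IsDitSet D → IsDitSet (∂ Π D)
  ∂-isDitSet Π D D-dit = ∪-isDitSet D-dit (int-isDitSet (∁ D ∪ Π))

  int-open : {S : PairSet U} → IsDitSet S → int S ≐ S
  int-open {S} S-dit x y = interior , open-set
    where
    interior : int S x y → S x y
    interior ¬c = dne (λ ¬s → ¬c (incl ¬s))
    open-set : S x y → int S x y
    open-set s c = EqClosure-minimal S-dit (λ ¬s → ¬s) c s

  module Implication {D P : PairSet U} (D-dit : IsDitSet D) (P-equiv : IsEquivalence P) where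

    module ∁D = IsEquivalence D-dit
    module P = IsEquivalence P-equiv

    C : PairSet U
    C = ∁ (∁ D ∪ ∁ P)

    C-intro : ∀ {x y} → D x y → P x y → C x y
    C-intro d p (inj₁ ¬d) = ¬d d
    C-intro d p (inj₂ ¬p) = ¬p p

    Splits-transport : ∀ {x y} → Splits D P x → P x y → Splits D P y
    Splits-transport {x} {y} (z , Pxz , Dxz) Pxy with em {D y z}
    ... | yes Dyz = z , P.trans (P.sym Pxy) Pxz , Dyz
    ... | no ¬Dyz = x , P.sym Pxy , dne (λ ¬Dyx → ∁D.trans (∁D.sym ¬Dyx) ¬Dyz Dxz)

    Indit⇒-isEquivalence : IsEquivalence (Indit⇒ D P)
    Indit⇒-isEquivalence = record { refl = inj₁ refl ; sym = sym′ ; trans = trans′ }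
      where
      sym′ : ∀ {x y} → Indit⇒ D P x y → Indit⇒ D P y x
      sym′ (inj₁ x≡y)         = inj₁ (≡.sym x≡y)
      sym′ (inj₂ (Pxy , spl)) = inj₂ (P.sym Pxy , Splits-transport spl Pxy)
      trans′ : ∀ {x y z} → Indit⇒ D P x y → Indit⇒ D P y z → Indit⇒ D P x z
      trans′ (inj₁ refl) q                       = q
      trans′ p (inj₁ refl)                       = p
      trans′ (inj₂ (Pxy , spl)) (inj₂ (Pyz , _)) = inj₂ (P.trans Pxy Pyz , spl)

    closure⇒Indit⇒ : EqClosure C ⇒ Indit⇒ D P
    closure⇒Indit⇒ = EqClosure-minimal Indit⇒-isEquivalence generator
      where
      generator : C ⇒ Indit⇒ D P
      generator {x} {y} c = inj₂ (Pxy , y , Pxy , dne (λ ¬d → c (inj₁ ¬d)))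
        where Pxy = dne (λ ¬p → c (inj₂ ¬p))

    -- A pair in a common block of ρ is joined through a point z of its π-block outside that block.
    Indit⇒⇒closure : Indit⇒ D P ⇒ EqClosure C
    Indit⇒⇒closure (inj₁ refl) = erefl
    Indit⇒⇒closure {x} {y} (inj₂ (Pxy , z , Pxz , Dxz)) with em {D x y}
    ... | yes Dxy = incl (C-intro Dxy Pxy)
    ... | no ¬Dxy = etrans (incl (C-intro Dxz Pxz)) (incl (C-intro Dzy (P.trans (P.sym Pxz) Pxy)))
      where Dzy = dne (λ ¬Dzy → ∁D.trans ¬Dxy (∁D.sym ¬Dzy) Dxz)

    ⇒ᵈ-dit : (D ⇒ᵈ ∁ P) ≐ ∁ (Indit⇒ D P)
    ⇒ᵈ-dit x y = (λ ¬c i → ¬c (Indit⇒⇒closure i)) , (λ ¬i c → ¬i (closure⇒Indit⇒ c))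

  ⇒ᵈ-∪-distrib : {S T P : PairSet U} → IsDitSet S → IsDitSet T → IsEquivalence P →
                 ((S ∪ T) ⇒ᵈ ∁ P) ≐ ((S ⇒ᵈ ∁ P) ∩ (T ⇒ᵈ ∁ P))
  ⇒ᵈ-∪-distrib {S} {T} {P} S-dit T-dit P-equiv x y = to , from
    where
    module IS = Implication S-dit P-equiv
    module IT = Implication T-dit P-equiv
    module IST = Implication (∪-isDitSet S-dit T-dit) P-equiv
    to : ((S ∪ T) ⇒ᵈ ∁ P) x y → ((S ⇒ᵈ ∁ P) ∩ (T ⇒ᵈ ∁ P)) x y
    to d = proj₂ (IS.⇒ᵈ-dit x y) (λ i → proj₁ (IST.⇒ᵈ-dit x y) d (Indit⇒-∪ˡ S T P i))
         , proj₂ (IT.⇒ᵈ-dit x y) (λ i → proj₁ (IST.⇒ᵈ-dit x y) d (Indit⇒-∪ʳ S T P i))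
    from : ((S ⇒ᵈ ∁ P) ∩ (T ⇒ᵈ ∁ P)) x y → ((S ∪ T) ⇒ᵈ ∁ P) x y
    from (dS , dT) = proj₂ (IST.⇒ᵈ-dit x y) λ i → excluded (Indit⇒-∪ S T P i)
      where
      excluded : ¬ (Indit⇒ S P x y ⊎ Indit⇒ T P x y)
      excluded (inj₁ iS) = proj₁ (IS.⇒ᵈ-dit x y) dS iS
      excluded (inj₂ iT) = proj₁ (IT.⇒ᵈ-dit x y) dT iT

  ∂-∨ᵈ-distrib : {S T P : PairSet U} → IsDitSet S → IsDitSet T → IsEquivalence P →
                 ∂ (∁ P) (S ∨ᵈ T) ≐ ((∂ (∁ P) S ∨ᵈ T) ∧ᵈ (S ∨ᵈ ∂ (∁ P) T))
  ∂-∨ᵈ-distrib {S} {T} {P} S-dit T-dit P-equiv =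
    ≐-trans (≐-sym (int-open (∂-isDitSet (∁ P) (S ∪ T) (∪-isDitSet S-dit T-dit))))
            (int-cong (≐-sym intersection≐∂))
    where
    intersection≐∂ : ((∂ (∁ P) S ∨ᵈ T) ∩ (S ∨ᵈ ∂ (∁ P) T)) ≐ ∂ (∁ P) (S ∨ᵈ T)
    intersection≐∂ = ≐-trans (∪-∩-distrib S T (S ⇒ᵈ ∁ P) (T ⇒ᵈ ∁ P))
                             (∪-congʳ (S ∪ T) (≐-sym (⇒ᵈ-∪-distrib S-dit T-dit P-equiv)))

mainTheorem19 : ExcludedMiddle 0ℓ → (U : Set) → Σ U (λ a → Σ U (λ b → ¬ a ≡ b)) →
    (σ τ π : Partition U) →
    ∂ (dit π) (dit σ ∨ᵈ dit τ) ≐ ((∂ (dit π) (dit σ) ∨ᵈ dit τ) ∧ᵈ (dit σ ∨ᵈ ∂ (dit π) (dit τ)))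
mainTheorem19 em U _ σ τ π =
  ∂-∨ᵈ-distrib (dit-isDitSet σ) (dit-isDitSet τ) (Partition.isEquiv π)
  where open Classical em
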